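{- Let $(G,b,x,k)$ be an instance of Collapsed $k$-Core and let $G'$ be the graph obtained from $G$ by adding a new vertex adjacent to all vertices of $G$. Then $(G',b+1,x,k)$ is an instance of Collapsed $k$-Core that is equivalent to $(G,b,x,k)$ (i.e., one is a yes-instance if and only if the other is).
   Context: For an integer $k$, the $k$-core of an undirected graph $H$ is the (uniquely determined) largest induced subgraph of $H$ with minimum degree at least $k$; its size is its number of vertices. Collapsed $k$-Core: given an undirected graph $G=(V,E)$ and integers $b$, $x$, $k$, decide whether there is a set $S \subseteq V$ with $|S|\le b$ such that the $k$-core of $G-S$ has at most $x$ vertices. -}

module Defs where

open import Data.Nat using (ℕ; suc; _≤_)
open import Data.Integer using (ℤ; +_) renaming (_≤_ to _≤ℤ_)
open import Data.Bool using (Bool; true; false; if_then_else_; _∧_)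
open import Data.Fin using (Fin; zero; suc)
open import Data.Fin.Subset using (Subset; _∈_; _∉_; _⊆_; ∣_∣)
open import Data.Vec using (lookup)
open import Data.List using (List; map; allFin)
open import Data.Nat.ListAction using (sum)
open import Data.Product using (Σ; _×_)
open import Relation.Binary.PropositionalEquality using (_≡_)

record Graph : Set where
  field
    n     : ℕ
    adj   : Fin n → Fin n → Bool
    sym   : ∀ u v → adj u v ≡ adj v u
    irrefl : ∀ v → adj v v ≡ false
open Graph public

degIn : (G : Graph) → Subset (n G) → Fin (n G) → ℕ
degIn G T v = sum (map (λ u → if lookup T u ∧ adj G v u then 1 else 0) (allFin (n G)))

MinDeg≥ : (G : Graph) → ℤ → Subset (n G) → Set
MinDeg≥ G k T = ∀ v → v ∈ T → k ≤ℤ + degIn G T v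

-- T avoids the deleted set S, i.e. T is a vertex set of G - S
Avoids : (G : Graph) → Subset (n G) → Subset (n G) → Set
Avoids G S T = ∀ v → v ∈ T → v ∉ S

IsKCore : (G : Graph) → ℤ → (S T : Subset (n G)) → Set
IsKCore G k S T =
  Avoids G S T × MinDeg≥ G k T ×
  (∀ T′ → Avoids G S T′ → MinDeg≥ G k T′ → T′ ⊆ T)

CoreAtMost : (G : Graph) → ℤ → Subset (n G) → ℕ → Set
CoreAtMost G k S x = Σ (Subset (n G)) λ T → IsKCore G k S T × ∣ T ∣ ≤ x

CollapsedKCore : Graph → ℕ → ℕ → ℤ → Set
CollapsedKCore G b x k =
  Σ (Subset (n G)) λ S → ∣ S ∣ ≤ b × CoreAtMost G k S x

apexAdj : (G : Graph) → Fin (suc (n G)) → Fin (suc (n G)) → Bool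
apexAdj G zero    zero    = false
apexAdj G zero    (suc v) = true
apexAdj G (suc u) zero    = true
apexAdj G (suc u) (suc v) = adj G u v

apexSym : (G : Graph) → ∀ u v → apexAdj G u v ≡ apexAdj G v u
apexSym G zero    zero    = Relation.Binary.PropositionalEquality.refl
apexSym G zero    (suc v) = Relation.Binary.PropositionalEquality.refl
apexSym G (suc u) zero    = Relation.Binary.PropositionalEquality.refl
apexSym G (suc u) (suc v) = sym G u v

apexIrrefl : (G : Graph) → ∀ v → apexAdj G v v ≡ false
apexIrrefl G zero    = Relation.Binary.PropositionalEquality.refl
apexIrrefl G (suc v) = irrefl G v

addApex : Graph → Graph
addApex G = record
  { n = suc (n G) ; adj = apexAdj G ; sym = apexSym G ; irrefl = apexIrrefl G }

-- Adding a universal vertex a costs one unit of budget and never helps.  A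
-- solution S of G gives the solution S + a of G′ with the same core.  For a
-- solution S′ of G′ containing a, drop a.  If a ∉ S′, remove one vertex h from
-- S′ to get S₀ of size at most b; the k-core C of G - S₀ has at most one vertex
-- (h) outside G - S′.  Either C is empty, or every vertex of C has degree at
-- most |C ∖ {h}|, so k ≤ |C ∖ {h}|; then a together with C ∖ {h} has minimum
-- degree ≥ k in G′ - S′ (a replaces h as a neighbour), hence lies in its k-core,
-- which therefore has at least |C| vertices.
module Submission where

open import Defs hiding (sym)
open import Data.Bool using (Bool; true; false; if_then_else_; _∧_)
open import Data.Bool.Properties using (∧-identityʳ)
open import Data.Empty using (⊥-elim)
open import Data.Fin using (Fin; zero; suc)
open import Data.Fin.Properties using (all?)
open import Data.Fin.Subset
  using (Subset; _∈_; _⊆_; ∣_∣; ⊥; _∪_; _∩_; ∁; _-_; Empty)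
open import Data.Fin.Subset.Properties
  using ( _∈?_; x∈p∪q⁻; x∈p∪q⁺; p⊆p∪q; x∈p∩q⁺; x∈p∩q⁻; x∉p⇒x∈∁p; x∈∁p⇒x∉p; p∩q⊆p; drop-there; x∈p∧x∉q⇒x∈p─q
        ; p⊆q⇒∣p∣≤∣q∣; x∈p⇒∣p-x∣<∣p∣; x≢y⇒x∉⁅y⁆; nonempty?; Empty-unique
        ; ∣⊥∣≡0; anySubset? )
open import Data.Integer using (ℤ; +_; +≤+) renaming (_≤_ to _≤ℤ_)
open import Data.Integer.Properties using (_≤?_) renaming (≤-trans to ≤ℤ-trans)
import Data.List as List
open import Data.List.Properties using (map-tabulate)
open import Data.Nat using (ℕ; suc; _+_; _≤_; _<_; z≤n; s≤s)
open import Data.Nat.ListAction using (sum)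
open import Data.Nat.Properties
  using (≤-trans; ≤-reflexive; +-monoʳ-≤; n≤1+n; +-suc; +-comm; ≤-pred)
open import Data.Product using (Σ; ∃; _×_; _,_; proj₂)
open import Data.Sum using (inj₁; inj₂)
open import Data.Vec using (_∷_; []; lookup; tabulate; here; there)
open import Data.Vec.Properties using (lookup∘tabulate; lookup⇒[]=; []=⇒lookup)
open import Relation.Nullary using (Dec; yes; no; ¬?; does)
open import Relation.Nullary.Decidable using (_×-dec_; _→-dec_; dec-true)
open import Relation.Binary.PropositionalEquality
  using (_≡_; refl; sym; trans; cong; cong₂; subst; _≢_; module ≡-Reasoning)

m+r≤1+m : ∀ {m r} → r ≤ 1 → m + r ≤ suc m
m+r≤1+m {m} r≤1 = ≤-trans (+-monoʳ-≤ m r≤1) (≤-reflexive (+-comm m 1))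

∣p∪q∣≤∣p∣+∣q∣ : ∀ {n} (p q : Subset n) → ∣ p ∪ q ∣ ≤ ∣ p ∣ + ∣ q ∣
∣p∪q∣≤∣p∣+∣q∣ []          []          = z≤n
∣p∪q∣≤∣p∣+∣q∣ (true  ∷ p) (true  ∷ q) = s≤s (≤-trans (∣p∪q∣≤∣p∣+∣q∣ p q) (+-monoʳ-≤ ∣ p ∣ (n≤1+n ∣ q ∣)))
∣p∪q∣≤∣p∣+∣q∣ (true  ∷ p) (false ∷ q) = s≤s (∣p∪q∣≤∣p∣+∣q∣ p q)
∣p∪q∣≤∣p∣+∣q∣ (false ∷ p) (true  ∷ q) = ≤-trans (s≤s (∣p∪q∣≤∣p∣+∣q∣ p q)) (≤-reflexive (sym (+-suc ∣ p ∣ ∣ q ∣)))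
∣p∪q∣≤∣p∣+∣q∣ (false ∷ p) (false ∷ q) = ∣p∪q∣≤∣p∣+∣q∣ p q

p⊆q∪r⇒∣p∣≤∣q∣+∣r∣ : ∀ {n} {p q r : Subset n} → p ⊆ q ∪ r → ∣ p ∣ ≤ ∣ q ∣ + ∣ r ∣
p⊆q∪r⇒∣p∣≤∣q∣+∣r∣ {q = q} {r} p⊆q∪r = ≤-trans (p⊆q⇒∣p∣≤∣q∣ p⊆q∪r) (∣p∪q∣≤∣p∣+∣q∣ q r)

∣p∣≤1+b⇒p⊆q∪r : ∀ {n} b (p : Subset n) → ∣ p ∣ ≤ suc b →
  ∃ λ q → ∃ λ r → ∣ q ∣ ≤ b × ∣ r ∣ ≤ 1 × p ⊆ q ∪ r
∣p∣≤1+b⇒p⊆q∪r b [] _ = [] , [] , z≤n , z≤n , λ ()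
∣p∣≤1+b⇒p⊆q∪r {suc n} b (true ∷ p) (s≤s ∣p∣≤b) =
  false ∷ p , true ∷ ⊥ , ∣p∣≤b , s≤s (≤-reflexive (∣⊥∣≡0 n)) , cover
  where
  cover : true ∷ p ⊆ (false ∷ p) ∪ (true ∷ ⊥)
  cover here          = here
  cover (there x∈p) = there (p⊆p∪q ⊥ x∈p)
∣p∣≤1+b⇒p⊆q∪r b (false ∷ p) ∣p∣≤1+b
  with q , r , ∣q∣≤b , ∣r∣≤1 , p⊆q∪r ← ∣p∣≤1+b⇒p⊆q∪r b p ∣p∣≤1+b =
  false ∷ q , false ∷ r , ∣q∣≤b , ∣r∣≤1 , λ { (there x∈p) → there (p⊆q∪r x∈p) }

Empty⇒∣p∣≡0 : ∀ {n} {p : Subset n} → Empty p → ∣ p ∣ ≡ 0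
Empty⇒∣p∣≡0 {n} empty = trans (cong ∣_∣ (Empty-unique empty)) (∣⊥∣≡0 n)

module _ {n : ℕ} {P : Fin n → Set} (P? : ∀ v → Dec (P v)) where

  selection : Subset n
  selection = tabulate (λ v → does (P? v))

  ∈-selection⁺ : ∀ {v} → P v → v ∈ selection
  ∈-selection⁺ {v} pv = lookup⇒[]= v selection (trans (lookup∘tabulate _ v) (dec-true (P? v) pv))

  ∈-selection⁻ : ∀ {v} → v ∈ selection → P v
  ∈-selection⁻ {v} v∈ with P? v | trans (sym (lookup∘tabulate _ v)) ([]=⇒lookup v∈)
  ... | yes pv | _ = pv

p∩tabulate-true≡p : ∀ {n} (p : Subset n) → p ∩ tabulate (λ _ → true) ≡ p
p∩tabulate-true≡p []      = refl
p∩tabulate-true≡p (x ∷ p) = cong₂ _∷_ (∧-identityʳ x) (p∩tabulate-true≡p p)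

neighbours : (G : Graph) → Fin (n G) → Subset (n G)
neighbours G v = tabulate (adj G v)

∈-neighbours⁻ : ∀ G {u v} → u ∈ neighbours G v → adj G v u ≡ true
∈-neighbours⁻ G {u} u∈ = trans (sym (lookup∘tabulate _ u)) ([]=⇒lookup u∈)

sum-indicator≡∣∩∣ : ∀ {m} (T : Subset m) (a : Fin m → Bool) →
  sum (List.tabulate (λ u → if lookup T u ∧ a u then 1 else 0)) ≡ ∣ T ∩ tabulate a ∣
sum-indicator≡∣∩∣ []      a = refl
sum-indicator≡∣∩∣ (t ∷ T) a with t ∧ a zero
... | true  = cong suc (sum-indicator≡∣∩∣ T (λ u → a (suc u)))
... | false = sum-indicator≡∣∩∣ T (λ u → a (suc u))

degIn≡∣∩neighbours∣ : ∀ G T v → degIn G T v ≡ ∣ T ∩ neighbours G v ∣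
degIn≡∣∩neighbours∣ G T v = begin
  sum (List.map f (List.allFin (n G)))  ≡⟨ cong sum (map-tabulate (λ u → u) f) ⟩
  sum (List.tabulate f)                 ≡⟨ sum-indicator≡∣∩∣ T (adj G v) ⟩
  ∣ T ∩ neighbours G v ∣                ∎
  where
  open ≡-Reasoning
  f : Fin (n G) → ℕ
  f u = if lookup T u ∧ adj G v u then 1 else 0

degIn-mono : ∀ G {T U} v → T ⊆ U → degIn G T v ≤ degIn G U v
degIn-mono G {T} {U} v T⊆U rewrite degIn≡∣∩neighbours∣ G T v | degIn≡∣∩neighbours∣ G U v =
  p⊆q⇒∣p∣≤∣q∣ λ u∈ → let u∈T , u∈N = x∈p∩q⁻ T _ u∈ in x∈p∩q⁺ (T⊆U u∈T , u∈N)

degIn-⊆∪ : ∀ G {T U R} v → T ⊆ U ∪ R → degIn G T v ≤ degIn G U v + ∣ R ∣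
degIn-⊆∪ G {T} {U} {R} v T⊆U∪R
  rewrite degIn≡∣∩neighbours∣ G T v | degIn≡∣∩neighbours∣ G U v =
  p⊆q∪r⇒∣p∣≤∣q∣+∣r∣ T∩N⊆U∩N∪R
  where
  T∩N⊆U∩N∪R : T ∩ neighbours G v ⊆ (U ∩ neighbours G v) ∪ R
  T∩N⊆U∩N∪R u∈ with u∈T , u∈N ← x∈p∩q⁻ T _ u∈ | x∈p∪q⁻ U R (T⊆U∪R u∈T)
  ... | inj₁ u∈U = x∈p∪q⁺ (inj₁ (x∈p∩q⁺ (u∈U , u∈N)))
  ... | inj₂ u∈R = x∈p∪q⁺ (inj₂ u∈R)

degIn<∣T∣ : ∀ G {T v} → v ∈ T → degIn G T v < ∣ T ∣
degIn<∣T∣ G {T} {v} v∈T rewrite degIn≡∣∩neighbours∣ G T v =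
  ≤-trans (s≤s (p⊆q⇒∣p∣≤∣q∣ T∩N⊆T-v)) (x∈p⇒∣p-x∣<∣p∣ v∈T)
  where
  T∩N⊆T-v : T ∩ neighbours G v ⊆ T - v
  T∩N⊆T-v {u} u∈ with u∈T , u∈N ← x∈p∩q⁻ T _ u∈ =
    x∈p∧x∉q⇒x∈p─q u∈T (x≢y⇒x∉⁅y⁆ u≢v)
    where
    u≢v : u ≢ v
    u≢v refl with () ← trans (sym (∈-neighbours⁻ G u∈N)) (irrefl G v)

degIn-addApex-suc-apex∉ : ∀ G T v → degIn (addApex G) (false ∷ T) (suc v) ≡ degIn G T v
degIn-addApex-suc-apex∉ G T v =
  trans (degIn≡∣∩neighbours∣ (addApex G) (false ∷ T) (suc v)) (sym (degIn≡∣∩neighbours∣ G T v))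

degIn-addApex-suc-apex∈ : ∀ G T v → degIn (addApex G) (true ∷ T) (suc v) ≡ suc (degIn G T v)
degIn-addApex-suc-apex∈ G T v =
  trans (degIn≡∣∩neighbours∣ (addApex G) (true ∷ T) (suc v)) (cong suc (sym (degIn≡∣∩neighbours∣ G T v)))

degIn-addApex-zero : ∀ G T → degIn (addApex G) (true ∷ T) zero ≡ ∣ T ∣
degIn-addApex-zero G T =
  trans (degIn≡∣∩neighbours∣ (addApex G) (true ∷ T) zero) (cong ∣_∣ (p∩tabulate-true≡p T))

module _ (G : Graph) (k : ℤ) (S : Subset (n G)) where

  avoids? : ∀ T → Dec (Avoids G S T)
  avoids? T = all? λ v → (v ∈? T) →-dec ¬? (v ∈? S)

  minDeg≥? : ∀ T → Dec (MinDeg≥ G k T)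
  minDeg≥? T = all? λ v → (v ∈? T) →-dec (k ≤? + degIn G T v)

  -- The k-core is the union of all vertex sets of G - S of minimum degree at least k.
  kCore : Σ (Subset (n G)) (IsKCore G k S)
  kCore = core , avoids , minDeg , maximal
    where
    inGoodSet? : ∀ v → Dec (∃ λ T → (Avoids G S T × MinDeg≥ G k T) × v ∈ T)
    inGoodSet? v = anySubset? λ T → (avoids? T ×-dec minDeg≥? T) ×-dec (v ∈? T)

    core : Subset (n G)
    core = selection inGoodSet?

    avoids : Avoids G S core
    avoids v v∈ with _ , (avT , _) , v∈T ← ∈-selection⁻ inGoodSet? v∈ = avT v v∈T

    minDeg : MinDeg≥ G k core
    minDeg v v∈ with T , goodT , v∈T ← ∈-selection⁻ inGoodSet? v∈ =
      ≤ℤ-trans (proj₂ goodT v v∈T) (+≤+ (degIn-mono G v λ u∈T → ∈-selection⁺ inGoodSet? (T , goodT , u∈T)))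

    maximal : ∀ T → Avoids G S T → MinDeg≥ G k T → T ⊆ core
    maximal T avT mdT v∈T = ∈-selection⁺ inGoodSet? (T , (avT , mdT) , v∈T)

module _ {G : Graph} {k : ℤ} where

  avoids-addApex⁺ : ∀ {s S T} → Avoids G S T → Avoids (addApex G) (s ∷ S) (false ∷ T)
  avoids-addApex⁺ avT (suc v) (there v∈T) (there v∈S) = avT v v∈T v∈S

  avoids-addApex⁻ : ∀ {s t S T} → Avoids (addApex G) (s ∷ S) (t ∷ T) → Avoids G S T
  avoids-addApex⁻ avT v v∈T v∈S = avT (suc v) (there v∈T) (there v∈S)

  minDeg-addApex⁺ : ∀ {T} → MinDeg≥ G k T → MinDeg≥ (addApex G) k (false ∷ T)
  minDeg-addApex⁺ {T} mdT (suc v) (there v∈T) =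
    subst (λ d → k ≤ℤ + d) (sym (degIn-addApex-suc-apex∉ G T v)) (mdT v v∈T)

  minDeg-addApex⁻ : ∀ {T} → MinDeg≥ (addApex G) k (false ∷ T) → MinDeg≥ G k T
  minDeg-addApex⁻ {T} mdT v v∈T =
    subst (λ d → k ≤ℤ + d) (degIn-addApex-suc-apex∉ G T v) (mdT (suc v) (there v∈T))

  isKCore-addApex⁺ : ∀ {S T} → IsKCore G k S T → IsKCore (addApex G) k (true ∷ S) (false ∷ T)
  isKCore-addApex⁺ {S} {T} (avT , mdT , maxT) = avoids-addApex⁺ avT , minDeg-addApex⁺ mdT , maximal
    where
    maximal : ∀ T′ → Avoids (addApex G) (true ∷ S) T′ → MinDeg≥ (addApex G) k T′ → T′ ⊆ false ∷ T
    maximal (true  ∷ T′) av _  = ⊥-elim (av zero here here)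
    maximal (false ∷ T′) av md (there v∈T′) =
      there (maxT T′ (avoids-addApex⁻ av) (minDeg-addApex⁻ md) v∈T′)

  isKCore-addApex⁻ : ∀ {S T} → IsKCore (addApex G) k (true ∷ S) (false ∷ T) → IsKCore G k S T
  isKCore-addApex⁻ (avT , mdT , maxT) =
    avoids-addApex⁻ avT , minDeg-addApex⁻ mdT ,
    λ T′ av md v∈T′ → drop-there (maxT (false ∷ T′) (avoids-addApex⁺ av) (minDeg-addApex⁺ md) (there v∈T′))

  -- The apex takes over the role of the one vertex of C that C′ may miss.
  minDeg-addApex-apex∈ : ∀ {C C′ R} → C′ ⊆ C → C ⊆ C′ ∪ R → ∣ R ∣ ≤ 1 →
    MinDeg≥ G k C → k ≤ℤ + ∣ C′ ∣ → MinDeg≥ (addApex G) k (true ∷ C′)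
  minDeg-addApex-apex∈ {C} {C′} C′⊆C C⊆C′∪R ∣R∣≤1 mdC k≤∣C′∣ = λ where
    zero    here          → subst (λ d → k ≤ℤ + d) (sym (degIn-addApex-zero G C′)) k≤∣C′∣
    (suc u) (there u∈C′) → subst (λ d → k ≤ℤ + d) (sym (degIn-addApex-suc-apex∈ G C′ u))
      (≤ℤ-trans (mdC u (C′⊆C u∈C′)) (+≤+ (≤-trans (degIn-⊆∪ G u C⊆C′∪R) (m+r≤1+m ∣R∣≤1))))

  kCore-size-≤-addApex : ∀ {S S₀ R C D} → S ⊆ S₀ ∪ R → ∣ R ∣ ≤ 1 →
    IsKCore G k S₀ C → IsKCore (addApex G) k (false ∷ S) D → ∣ C ∣ ≤ ∣ D ∣
  kCore-size-≤-addApex {S} {S₀} {R} {C} {D} S⊆S₀∪R ∣R∣≤1 (avC , mdC , _) (_ , _ , maxD)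
    with nonempty? C
  ... | no empty = subst (_≤ ∣ D ∣) (sym (Empty⇒∣p∣≡0 empty)) z≤n
  ... | yes (w , w∈C) =
    ≤-trans ∣C∣≤1+∣C′∣ (p⊆q⇒∣p∣≤∣q∣ (maxD (true ∷ C′) avoidsS (minDeg-addApex-apex∈ C′⊆C C⊆C′∪R ∣R∣≤1 mdC k≤∣C′∣)))
    where
    C′ : Subset (n G)
    C′ = C ∩ ∁ S

    C′⊆C : C′ ⊆ C
    C′⊆C = p∩q⊆p C (∁ S)

    C⊆C′∪R : C ⊆ C′ ∪ R
    C⊆C′∪R {u} u∈C with u ∈? S
    ... | no u∉S = x∈p∪q⁺ (inj₁ (x∈p∩q⁺ (u∈C , x∉p⇒x∈∁p u∉S)))
    ... | yes u∈S with x∈p∪q⁻ S₀ R (S⊆S₀∪R u∈S)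
    ...   | inj₁ u∈S₀ = ⊥-elim (avC u u∈C u∈S₀)
    ...   | inj₂ u∈R  = x∈p∪q⁺ (inj₂ u∈R)

    ∣C∣≤1+∣C′∣ : ∣ C ∣ ≤ suc ∣ C′ ∣
    ∣C∣≤1+∣C′∣ = ≤-trans (p⊆q∪r⇒∣p∣≤∣q∣+∣r∣ C⊆C′∪R) (m+r≤1+m ∣R∣≤1)

    k≤∣C′∣ : k ≤ℤ + ∣ C′ ∣
    k≤∣C′∣ = ≤ℤ-trans (mdC w w∈C) (+≤+ (≤-pred (≤-trans (degIn<∣T∣ G w∈C) ∣C∣≤1+∣C′∣)))

    avoidsS : Avoids (addApex G) (false ∷ S) (true ∷ C′)
    avoidsS zero    _             ()
    avoidsS (suc u) (there u∈C′) (there u∈S) = x∈∁p⇒x∉p (proj₂ (x∈p∩q⁻ C (∁ S) u∈C′)) u∈S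

mainTheorem9 : (G : Graph) (b x : ℕ) (k : ℤ) →
    (CollapsedKCore G b x k → CollapsedKCore (addApex G) (suc b) x k) ×
    (CollapsedKCore (addApex G) (suc b) x k → CollapsedKCore G b x k)
mainTheorem9 G b x k = forward , backward
  where
  forward : CollapsedKCore G b x k → CollapsedKCore (addApex G) (suc b) x k
  forward (S , ∣S∣≤b , T , T-core , ∣T∣≤x) =
    true ∷ S , s≤s ∣S∣≤b , false ∷ T , isKCore-addApex⁺ T-core , ∣T∣≤x

  backward : CollapsedKCore (addApex G) (suc b) x k → CollapsedKCore G b x k
  backward (true ∷ S , _ , true ∷ D , (avD , _) , _) = ⊥-elim (avD zero here here)
  backward (true ∷ S , s≤s ∣S∣≤b , false ∷ D , D-core , ∣D∣≤x) =
    S , ∣S∣≤b , D , isKCore-addApex⁻ D-core , ∣D∣≤x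
  backward (false ∷ S , ∣S∣≤1+b , D , D-core , ∣D∣≤x)
    with S₀ , R , ∣S₀∣≤b , ∣R∣≤1 , S⊆S₀∪R ← ∣p∣≤1+b⇒p⊆q∪r b S ∣S∣≤1+b
    with C , C-core ← kCore G k S₀ =
    S₀ , ∣S₀∣≤b , C , C-core , ≤-trans (kCore-size-≤-addApex S⊆S₀∪R ∣R∣≤1 C-core D-core) ∣D∣≤x
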